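{- Let $G$ be the graph constructed in the context from a formula $\phi$ with variable classes of size $n$. Then the minimum vertex cover size of $G$ is $O(n/\log n)$.
   Context: Construction: Let $\phi$ be a 3-CNF formula with $m$ clauses whose variables are partitioned into $V_1,V_2,V_3$ with $|V_p|=n$, such that no clause contains more than one variable from any $V_p$. Assume $n$ is a power of $4$; logarithms are base $2$. Partition each $V_p$ ($p\in[3]$) into $\log n$ sets $V_p^q$ ($q\in[\log n]$), each of size at most $\lceil n/\log n\rceil$. Let $L=\lceil n/\log^2 n\rceil$ and partition each $V_p^q$ into $2L$ sets $\mathcal V^{p,q}_\alpha$ ($\alpha\in[2L]$) of sizes as equal as possible. Let $R=\sqrt n$, $A=n^2+m$. For each $p,q,\alpha$ fix a map $\beta\mapsto\sigma^{p,q}_{\alpha,\beta}$ from $[R]$ onto the set of truth assignments of $\mathcal V^{p,q}_\alpha$. Attaching a force gadget to a vertex $u$ means adding $A+1$ new vertices $\bar u$ (the gadget twin) and $u_1,\dots,u_A$ (gadget leaves) with edges $u\bar u$, $uu_i$, $\bar u u_i$ for $i\in[A]$. For each $p\in[3],q\in[\log n]$ the choice gadget $G_p^q$ has vertices $\ell_i,\ell'_i,\kappa_i,\lambda_i$ ($i\in[2L]$), $r_j$ ($j\in[R]$), $m^i_j$ ($i\in[2L],j\in[R]$); its edges are $\kappa_i\lambda_i$ and, for all $i,j$, $\kappa_i m^i_j$, $\lambda_i m^i_j$, $\ell_i m^i_j$, $\ell'_i m^i_j$, $r_j m^i_j$; a force gadget is attached to every $\ell_i$, $\ell'_i$, $r_j$.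 The graph $G$ is the disjoint union of all $3\log n$ gadgets $G_p^q$ (with their force gadgets) plus one vertex $c$ per clause $C$ of $\phi$; $c$ is adjacent to $\ell_\alpha$ of $G_p^q$ whenever $\mathcal V^{p,q}_\alpha$ contains a variable of $C$, and for each such $\alpha$, $c$ is adjacent to $r_\beta$ of $G_p^q$ for every $\beta\in[R]$ such that $\sigma^{p,q}_{\alpha,\beta}$ satisfies $C$. -}

module Defs where

open import Data.Nat using (ℕ; zero; suc; _+_; _*_; _∸_; _^_; _≤_; _/_)
open import Data.Fin using (Fin; _≟_)
open import Data.Bool using (Bool)
open import Data.Product using (Σ; ∃; ∃-syntax; _×_; _,_)
open import Data.Sum using (_⊎_)
open import Data.List using (List; length; filter; allFin)
open import Data.List.Membership.Propositional using (_∈_)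
open import Relation.Binary.PropositionalEquality using (_≡_)
open import Relation.Nullary using (¬_)

-- Arithmetic conventions.  n is a power of 4: n = 4 ^ k.  Then
-- log n = 2k (log base 2) and √n = 2 ^ k exactly.

nOf : ℕ → ℕ
nOf k = 4 ^ k

lgOf : ℕ → ℕ
lgOf k = 2 * k

sqrtOf : ℕ → ℕ
sqrtOf k = 2 ^ k

-- ceiling division (⌈a/0⌉ := 0, never used for the relevant k ≥ 1)
ceilDiv : ℕ → ℕ → ℕ
ceilDiv a zero    = 0
ceilDiv a (suc b) = (a + b) / suc b

LOf : ℕ → ℕ
LOf k = ceilDiv (nOf k) (lgOf k * lgOf k)

-- 3-CNF formulas over variables V₁ ⊎ V₂ ⊎ V₃, each V_p = Fin n.
-- A literal is (p , v , b): variable v of class V_p with polarity b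
-- (the literal is true under an assignment τ iff τ v ≡ b).

Literal : ℕ → Set
Literal n = Fin 3 × Fin n × Bool

Clause : ℕ → Set
Clause n = List (Literal n)

countEq : ∀ {n b} → (Fin n → Fin b) → Fin b → ℕ
countEq {n} f a = length (filter (λ v → f v ≟ a) (allFin n))

countEq2 : ∀ {n b c} → (Fin n → Fin b) → Fin b → (Fin n → Fin c) → Fin c → ℕ
countEq2 {n} f a g x =
  length (filter (λ v → g v ≟ x) (filter (λ v → f v ≟ a) (allFin n)))

record Construction (k : ℕ) : Set where
  field
    m       : ℕ
    clause  : Fin m → Clause (nOf k)
    is3CNF  : ∀ i → length (clause i) ≤ 3
    onePerClass : ∀ i p v v' b b' →
      (p , v , b) ∈ clause i → (p , v' , b') ∈ clause i → v ≡ v'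
    -- V_p = ⋃_q V_p^q  (qOf p v = q  iff  v ∈ V_p^q)
    qOf     : Fin 3 → Fin (nOf k) → Fin (lgOf k)
    qSize   : ∀ p q → countEq (qOf p) q ≤ ceilDiv (nOf k) (lgOf k)
    -- V_p^q = ⋃_α 𝒱^{p,q}_α  (αOf p v = α for v ∈ V_p^q), sizes as equal as possible
    αOf     : Fin 3 → Fin (nOf k) → Fin (2 * LOf k)
    αBalanced : ∀ p q α α' →
      countEq2 (qOf p) q (αOf p) α ≤ countEq2 (qOf p) q (αOf p) α' + 1
    -- σ^{p,q}_{α,β}, β ∈ [R]: an assignment of 𝒱^{p,q}_α (only its values on
    -- 𝒱^{p,q}_α matter), and β ↦ σ^{p,q}_{α,β} is onto the assignments of 𝒱^{p,q}_α
    σ       : Fin 3 → Fin (lgOf k) → Fin (2 * LOf k) → Fin (sqrtOf k) →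
              Fin (nOf k) → Bool
    σOnto   : ∀ p q α (τ : Fin (nOf k) → Bool) → ∃[ β ] (∀ v →
              qOf p v ≡ q → αOf p v ≡ α → σ p q α β v ≡ τ v)

module _ {k : ℕ} (Φ : Construction k) where
  open Construction Φ

  n R A L2 lg : ℕ
  n  = nOf k
  R  = sqrtOf k
  A  = n * n + m
  L2 = 2 * LOf k
  lg = lgOf k

  Meets : Fin m → Fin 3 → Fin lg → Fin L2 → Set
  Meets i p q α = ∃[ v ] ∃[ b ] ((p , v , b) ∈ clause i × qOf p v ≡ q × αOf p v ≡ α)

  Satisfies : Fin m → Fin 3 → Fin lg → Fin L2 → Fin R → Set
  Satisfies i p q α β = ∃[ v ] ∃[ b ]
    ((p , v , b) ∈ clause i × qOf p v ≡ q × αOf p v ≡ α × σ p q α β v ≡ b)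

  -- the vertices that receive a force gadget
  data Forced : Set where
    fℓ fℓ' : Fin 3 → Fin lg → Fin L2 → Forced
    fr     : Fin 3 → Fin lg → Fin R → Forced

  data Vertex : Set where
    ℓ ℓ' κ λ' : Fin 3 → Fin lg → Fin L2 → Vertex
    r         : Fin 3 → Fin lg → Fin R → Vertex
    μ         : Fin 3 → Fin lg → Fin L2 → Fin R → Vertex
    twin      : Forced → Vertex
    leaf      : Forced → Fin A → Vertex
    c         : Fin m → Vertex

  base : Forced → Vertex
  base (fℓ p q i)  = ℓ p q i
  base (fℓ' p q i) = ℓ' p q i
  base (fr p q j)  = r p q j

  -- the edges of G (each undirected edge listed in one orientation)
  data Edge : Vertex → Vertex → Set where
    κλ    : ∀ {p q i}   → Edge (κ p q i) (λ' p q i)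
    κμ    : ∀ {p q i j} → Edge (κ p q i) (μ p q i j)
    λμ    : ∀ {p q i j} → Edge (λ' p q i) (μ p q i j)
    ℓμ    : ∀ {p q i j} → Edge (ℓ p q i) (μ p q i j)
    ℓ'μ   : ∀ {p q i j} → Edge (ℓ' p q i) (μ p q i j)
    rμ    : ∀ {p q i j} → Edge (r p q j) (μ p q i j)
    utw   : ∀ {u}       → Edge (base u) (twin u)
    uleaf : ∀ {u a}     → Edge (base u) (leaf u a)
    tleaf : ∀ {u a}     → Edge (twin u) (leaf u a)
    cℓ    : ∀ {i p q α} → Meets i p q α → Edge (c i) (ℓ p q α)
    cr    : ∀ {i p q α β} → Meets i p q α → Satisfies i p q α β →
            Edge (c i) (r p q β)

  IsVertexCover : List Vertex → Set
  IsVertexCover S = ∀ {u v} → Edge u v → u ∈ S ⊎ v ∈ S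

  MinVertexCover≤ : ℕ → Set
  MinVertexCover≤ s = Σ (List Vertex) λ S → IsVertexCover S × length S ≤ s

{-# OPTIONS --safe #-}
-- In every choice gadget take ℓᵢ, ℓ'ᵢ, κᵢ, λᵢ, all rⱼ, and the twins of the
-- forced vertices.  Every edge is covered: the mᵢⱼ, the gadget leaves and the
-- clause vertices only have neighbours among these.  The cover has
-- 3 log n · (12 L + 2 √n) vertices, which is O(n / log n) because
-- L ≈ n / log² n and log² n · √n = O(n).
module Submission where

open import Defs
open import Data.Nat using (ℕ; zero; suc; _+_; _*_; _^_; _≤_; _<_; _/_; z≤n; s≤s)
open import Data.Nat.Properties
open import Data.Nat.DivMod using (m/n*n≤m)
open import Data.Nat.Solver using (module +-*-Solver)
open +-*-Solver using (solve; _:=_; _:+_; _:*_; con)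
open import Data.Fin using (Fin)
open import Data.Product using (∃-syntax; _×_; _,_)
open import Data.Sum using (inj₁; inj₂)
open import Data.List using (List; []; _∷_; _++_; length; concatMap; allFin)
open import Data.List.Properties using (length-++; length-tabulate)
open import Data.List.Membership.Propositional using (_∈_; lose)
open import Data.List.Membership.Propositional.Properties
  using (∈-++⁺ˡ; ∈-++⁺ʳ; ∈-concatMap⁺; ∈-allFin)
open import Data.List.Relation.Binary.Subset.Propositional using (_⊆_)
open import Data.List.Relation.Unary.Any using (here; there)
open import Function using (_∘_; id)
open import Relation.Binary.PropositionalEquality

module _ {A B : Set} where

  length-concatMap-const : ∀ (f : A → List B) {l} → (∀ x → length (f x) ≡ l) →
                           ∀ xs → length (concatMap f xs) ≡ length xs * l
  length-concatMap-const f eq []       = refl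
  length-concatMap-const f eq (x ∷ xs) =
    trans (length-++ (f x)) (cong₂ _+_ (eq x) (length-concatMap-const f eq xs))

module _ {B : Set} where

  ∈-concatMap-allFin : ∀ {a} (f : Fin a → List B) i {y} → y ∈ f i → y ∈ concatMap f (allFin a)
  ∈-concatMap-allFin f i = ∈-concatMap⁺ f ∘ lose (∈-allFin i)

  length-concatMap-allFin : ∀ {a} (f : Fin a → List B) {l} → (∀ i → length (f i) ≡ l) →
                            length (concatMap f (allFin a)) ≡ a * l
  length-concatMap-allFin {a} f {l} eq =
    trans (length-concatMap-const f eq (allFin a)) (cong (_* l) (length-tabulate {n = a} id))

n<2^n : ∀ n → n < 2 ^ n
n<2^n zero    = s≤s z≤n
n<2^n (suc n) = begin
  suc (suc n)   ≤⟨ +-monoʳ-≤ 1 (n<2^n n) ⟩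
  1 + 2 ^ n     ≤⟨ +-monoˡ-≤ (2 ^ n) (m^n>0 2 n) ⟩
  2 ^ n + 2 ^ n ≡⟨ cong (2 ^ n +_) (sym (+-identityʳ (2 ^ n))) ⟩
  2 ^ suc n     ∎
  where open ≤-Reasoning

n*n≤2^[1+n] : ∀ n → n * n ≤ 2 ^ suc n
n*n≤2^[1+n] zero    = z≤n
n*n≤2^[1+n] (suc n) = begin
  suc n * suc n           ≡⟨ solve 1 (λ n → (con 1 :+ n) :* (con 1 :+ n)
                                          := n :* n :+ (con 1 :+ n) :+ n) refl n ⟩
  n * n + suc n + n       ≤⟨ +-mono-≤ (+-mono-≤ (n*n≤2^[1+n] n) (n<2^n n))
                                      (≤-trans (n≤1+n n) (n<2^n n)) ⟩
  2 ^ suc n + 2 ^ n + 2 ^ n ≡⟨ solve 1 (λ x → con 2 :* x :+ x :+ x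
                                             := con 2 :* (con 2 :* x)) refl (2 ^ n) ⟩
  2 ^ suc (suc n)         ∎
  where open ≤-Reasoning

4^n≡2^n*2^n : ∀ n → 4 ^ n ≡ 2 ^ n * 2 ^ n
4^n≡2^n*2^n zero    = refl
4^n≡2^n*2^n (suc n) = trans (cong (4 *_) (4^n≡2^n*2^n n))
  (solve 1 (λ x → con 4 :* (x :* x) := (con 2 :* x) :* (con 2 :* x)) refl (2 ^ n))

*-ceilDiv≤+ : ∀ a d → d * ceilDiv a d ≤ a + d
*-ceilDiv≤+ a zero    = z≤n
*-ceilDiv≤+ a (suc d) = begin
  suc d * ((a + d) / suc d) ≡⟨ *-comm (suc d) _ ⟩
  (a + d) / suc d * suc d   ≤⟨ m/n*n≤m (a + d) (suc d) ⟩
  a + d                     ≤⟨ +-monoʳ-≤ a (n≤1+n d) ⟩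
  a + suc d                 ∎
  where open ≤-Reasoning

coverSize : ℕ → ℕ
coverSize k = 3 * (lgOf k * (2 * LOf k * 6 + sqrtOf k * 2))

module _ (k : ℕ) where

  private
    lgₖ = lgOf k
    nₖ  = nOf k
    √nₖ = sqrtOf k
    Lₖ  = LOf k

  lg²≤8√n : lgₖ * lgₖ ≤ 8 * √nₖ
  lg²≤8√n = begin
    lgₖ * lgₖ     ≡⟨ solve 1 (λ k → (con 2 :* k) :* (con 2 :* k) := con 4 :* (k :* k)) refl k ⟩
    4 * (k * k)   ≤⟨ *-monoʳ-≤ 4 (n*n≤2^[1+n] k) ⟩
    4 * (2 * √nₖ) ≡⟨ sym (*-assoc 4 2 √nₖ) ⟩
    8 * √nₖ       ∎
    where open ≤-Reasoning

  √n≤n : √nₖ ≤ nₖ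
  √n≤n = begin
    √nₖ       ≡⟨ sym (*-identityʳ √nₖ) ⟩
    √nₖ * 1   ≤⟨ *-monoʳ-≤ √nₖ (m^n>0 2 k) ⟩
    √nₖ * √nₖ ≡⟨ sym (4^n≡2^n*2^n k) ⟩
    nₖ        ∎
    where open ≤-Reasoning

  lg²*√n≤8n : lgₖ * lgₖ * √nₖ ≤ 8 * nₖ
  lg²*√n≤8n = begin
    lgₖ * lgₖ * √nₖ ≤⟨ *-monoˡ-≤ √nₖ lg²≤8√n ⟩
    8 * √nₖ * √nₖ   ≡⟨ *-assoc 8 √nₖ √nₖ ⟩
    8 * (√nₖ * √nₖ) ≡⟨ cong (8 *_) (sym (4^n≡2^n*2^n k)) ⟩
    8 * nₖ          ∎
    where open ≤-Reasoning

  lg²*L≤9n : lgₖ * lgₖ * Lₖ ≤ 9 * nₖ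
  lg²*L≤9n = begin
    lgₖ * lgₖ * Lₖ ≤⟨ *-ceilDiv≤+ nₖ (lgₖ * lgₖ) ⟩
    nₖ + lgₖ * lgₖ ≤⟨ +-monoʳ-≤ nₖ (≤-trans lg²≤8√n (*-monoʳ-≤ 8 √n≤n)) ⟩
    nₖ + 8 * nₖ    ≡⟨ solve 1 (λ x → x :+ con 8 :* x := con 9 :* x) refl nₖ ⟩
    9 * nₖ         ∎
    where open ≤-Reasoning

  coverSize*lg≤372n : coverSize k * lgₖ ≤ 372 * nₖ
  coverSize*lg≤372n = begin
    coverSize k * lgₖ
      ≡⟨ solve 3 (λ g l r → con 3 :* (g :* (con 2 :* l :* con 6 :+ r :* con 2)) :* g
                           := con 36 :* (g :* g :* l) :+ con 6 :* (g :* g :* r))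
               refl lgₖ Lₖ √nₖ ⟩
    36 * (lgₖ * lgₖ * Lₖ) + 6 * (lgₖ * lgₖ * √nₖ)
      ≤⟨ +-mono-≤ (*-monoʳ-≤ 36 lg²*L≤9n) (*-monoʳ-≤ 6 lg²*√n≤8n) ⟩
    36 * (9 * nₖ) + 6 * (8 * nₖ)
      ≡⟨ solve 1 (λ x → con 36 :* (con 9 :* x) :+ con 6 :* (con 8 :* x) := con 372 :* x) refl nₖ ⟩
    372 * nₖ
      ∎
    where open ≤-Reasoning

module _ {k : ℕ} (Φ : Construction k) where

  forcedCover : Forced Φ → List (Vertex Φ)
  forcedCover u = base Φ u ∷ twin u ∷ []

  ℓ-block : Fin 3 → Fin (lg Φ) → Fin (L2 Φ) → List (Vertex Φ)
  ℓ-block p q i = κ p q i ∷ λ' p q i ∷ forcedCover (fℓ p q i) ++ forcedCover (fℓ' p q i)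

  gadgetCover : Fin 3 → Fin (lg Φ) → List (Vertex Φ)
  gadgetCover p q = concatMap (ℓ-block p q) (allFin (L2 Φ))
                 ++ concatMap (forcedCover ∘ fr p q) (allFin (R Φ))

  gadgetCovers : Fin 3 → List (Vertex Φ)
  gadgetCovers p = concatMap (gadgetCover p) (allFin (lg Φ))

  cover : List (Vertex Φ)
  cover = concatMap gadgetCovers (allFin 3)

  gadgetCover⊆cover : ∀ p q → gadgetCover p q ⊆ cover
  gadgetCover⊆cover p q = ∈-concatMap-allFin gadgetCovers p ∘ ∈-concatMap-allFin (gadgetCover p) q

  ℓ-block⊆cover : ∀ p q i → ℓ-block p q i ⊆ cover
  ℓ-block⊆cover p q i = gadgetCover⊆cover p q ∘ ∈-++⁺ˡ ∘ ∈-concatMap-allFin (ℓ-block p q) i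

  forcedCover⊆cover : ∀ u → forcedCover u ⊆ cover
  forcedCover⊆cover (fℓ p q i)  = ℓ-block⊆cover p q i ∘ there ∘ there ∘ ∈-++⁺ˡ
  forcedCover⊆cover (fℓ' p q i) =
    ℓ-block⊆cover p q i ∘ there ∘ there ∘ ∈-++⁺ʳ (forcedCover (fℓ p q i))
  forcedCover⊆cover (fr p q j)  =
    gadgetCover⊆cover p q ∘ ∈-++⁺ʳ _ ∘ ∈-concatMap-allFin (forcedCover ∘ fr p q) j

  cover-isVertexCover : IsVertexCover Φ cover
  cover-isVertexCover (κλ {p} {q} {i})              = inj₁ (ℓ-block⊆cover p q i (here refl))
  cover-isVertexCover (κμ {p} {q} {i})              = inj₁ (ℓ-block⊆cover p q i (here refl))
  cover-isVertexCover (λμ {p} {q} {i})              = inj₁ (ℓ-block⊆cover p q i (there (here refl)))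
  cover-isVertexCover (ℓμ {p} {q} {i})              = inj₁ (forcedCover⊆cover (fℓ p q i) (here refl))
  cover-isVertexCover (ℓ'μ {p} {q} {i})             = inj₁ (forcedCover⊆cover (fℓ' p q i) (here refl))
  cover-isVertexCover (rμ {p} {q} {j = j})          = inj₁ (forcedCover⊆cover (fr p q j) (here refl))
  cover-isVertexCover (utw {u})                     = inj₁ (forcedCover⊆cover u (here refl))
  cover-isVertexCover (uleaf {u})                   = inj₁ (forcedCover⊆cover u (here refl))
  cover-isVertexCover (tleaf {u})                   = inj₁ (forcedCover⊆cover u (there (here refl)))
  cover-isVertexCover (cℓ {p = p} {q} {α} _)        = inj₂ (forcedCover⊆cover (fℓ p q α) (here refl))
  cover-isVertexCover (cr {p = p} {q} {β = β} _ _)  = inj₂ (forcedCover⊆cover (fr p q β) (here refl))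

  length-cover : length cover ≡ coverSize k
  length-cover =
    length-concatMap-allFin gadgetCovers λ p → length-concatMap-allFin (gadgetCover p) λ q →
      trans (length-++ (concatMap (ℓ-block p q) (allFin (L2 Φ))))
            (cong₂ _+_ (length-concatMap-allFin (ℓ-block p q) (λ _ → refl))
                       (length-concatMap-allFin (forcedCover ∘ fr p q) (λ _ → refl)))

lemma7 : ∃[ C ] ∃[ N₀ ] (∀ k → N₀ ≤ k → (Φ : Construction k) →
           ∃[ s ] (MinVertexCover≤ Φ s × s * lgOf k ≤ C * nOf k))
lemma7 = 372 , 0 , λ k _ Φ →
  coverSize k ,
  (cover Φ , cover-isVertexCover Φ , ≤-reflexive (length-cover Φ)) ,
  coverSize*lg≤372n k
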